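{- Let $k\ge 3$, let $G_1,\ldots,G_k$ be pairwise disjoint connected graphs and $x_i\in V(G_i)$ for $i\in[k]$. Let $G$ be the circuit of $G_1,\ldots,G_k$ with respect to $x_1,\ldots,x_k$, i.e. the graph obtained from a cycle $C_k$ with vertices $c_1,\ldots,c_k$ in cyclic order (disjoint from all $G_i$) by identifying $x_i$ with $c_i$ for each $i\in[k]$. Then $$H(G,t)=\sum_{i=1}^k H(G_i,t)+\sum_{\{i,j\}\in\binom{[k]}{2},\ i<j} t^{\min(j-i,\,k-j+i)}\bigl(1+H_{x_i}(G_i,t)\bigr)\bigl(1+H_{x_j}(G_j,t)\bigr).$$
   Context: All graphs are finite, simple and connected; $d_G(u,v)$ denotes shortest-path distance. $[k]=\{1,\ldots,k\}$ and $\binom{A}{2}$ is the set of 2-element subsets of $A$. The Hosoya polynomial is $H(G,t)=\sum_{\{u,v\}\in\binom{V(G)}{2}} t^{d_G(u,v)}$ (no constant term), and for $u\in V(G)$ the partial Hosoya polynomial is $H_u(G,t)=\sum_{v\in V(G),v\ne u} t^{d_G(u,v)}$. -}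

module Defs where

open import Data.Nat using (ℕ; zero; suc; _+_; _*_; _∸_; _^_; _⊓_; _≡ᵇ_)
open import Data.Bool using (Bool; true; false; _∧_; _∨_; if_then_else_)
open import Data.Fin using (Fin; toℕ)
open import Data.Fin.Properties using () renaming (_≟_ to _≟ᶠ_)
open import Data.List using (List; []; _∷_; map; _++_; filter; length; allFin; concatMap)
open import Data.Nat.ListAction using (sum)
open import Data.Bool.ListAction using (any)
open import Data.Product using (Σ; _×_; _,_; ∃)
open import Data.Product.Properties using (≡-dec)
open import Relation.Nullary using (yes; no; ¬?; does)
open import Relation.Binary.PropositionalEquality using (_≡_; refl)
open import Relation.Binary.Definitions using (DecidableEquality)

-- all 2-element subsets {x,y} of a list, each listed once as (earlier , later)
pairs : {A : Set} → List A → List (A × A)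
pairs []       = []
pairs (x ∷ xs) = map (λ y → (x , y)) xs ++ pairs xs

-- Generic finite "graph data": a vertex type V with decidable equality,
-- a list vs enumerating all vertices exactly once, and a Boolean
-- adjacency relation adj.

module _ {V : Set} (_≟_ : DecidableEquality V) (vs : List V) (adj : V → V → Bool) where

  reach : ℕ → V → V → Bool
  reach zero    u v = does (u ≟ v)
  reach (suc m) u v = any (λ w → reach m u w ∧ adj w v) vs

  -- least m < b with f m = true, and b if there is none
  leastTrue : (ℕ → Bool) → ℕ → ℕ
  leastTrue f zero    = zero
  leastTrue f (suc b) = if f zero then zero else suc (leastTrue (λ m → f (suc m)) b)

  -- shortest-path distance d(u,v): the least length of a u-v walk
  -- (a shortest walk has length < |V|, so searching below |V| suffices
  -- in a connected graph)
  dist : V → V → ℕ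
  dist u v = leastTrue (λ m → reach m u v) (length vs)

  -- Hosoya polynomial evaluated at t:  Σ_{{u,v}} t^{d(u,v)}
  hosoya : ℕ → ℕ
  hosoya t = sum (map (λ { (u , v) → t ^ dist u v }) (pairs vs))

  partialHosoya : V → ℕ → ℕ
  partialHosoya u t = sum (map (λ v → t ^ dist u v) (filter (λ v → ¬? (v ≟ u)) vs))

record Graph (n : ℕ) : Set where
  field
    adj    : Fin n → Fin n → Bool
    sym    : ∀ u v → adj u v ≡ adj v u
    irrefl : ∀ u → adj u u ≡ false
open Graph public

Connected : {n : ℕ} → Graph n → Set
Connected {n} G = ∀ u v → ∃ λ m → reach _≟ᶠ_ (allFin n) (adj G) m u v ≡ true

d : {n : ℕ} → Graph n → Fin n → Fin n → ℕ
d {n} G = dist _≟ᶠ_ (allFin n) (adj G)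

H : {n : ℕ} → Graph n → ℕ → ℕ
H {n} G = hosoya _≟ᶠ_ (allFin n) (adj G)

Hpart : {n : ℕ} → Graph n → Fin n → ℕ → ℕ
Hpart {n} G = partialHosoya _≟ᶠ_ (allFin n) (adj G)

-- The cycle C_k on c_0,...,c_{k-1} (0-based; c_{i} ~ c_{i+1}, c_{k-1} ~ c_0)

cycAdj : (k : ℕ) → Fin k → Fin k → Bool
cycAdj k i j =
  (toℕ j ≡ᵇ suc (toℕ i)) ∨ (toℕ i ≡ᵇ suc (toℕ j)) ∨
  ((toℕ i ≡ᵇ 0) ∧ (suc (toℕ j) ≡ᵇ k)) ∨ ((toℕ j ≡ᵇ 0) ∧ (suc (toℕ i) ≡ᵇ k))

-- Vertices: the disjoint union Σ i, V(G_i) (c_i is identified with x_i).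
-- Edges: the edges of each G_i, plus x_i x_j whenever c_i c_j ∈ E(C_k).

module Circuit (k : ℕ) (n : Fin k → ℕ) (G : (i : Fin k) → Graph (n i))
               (x : (i : Fin k) → Fin (n i)) where

  CV : Set
  CV = Σ (Fin k) (λ i → Fin (n i))

  _≟ᶜ_ : DecidableEquality CV
  _≟ᶜ_ = ≡-dec _≟ᶠ_ _≟ᶠ_

  cverts : List CV
  cverts = concatMap (λ i → map (λ a → (i , a)) (allFin (n i))) (allFin k)

  cadj : CV → CV → Bool
  cadj (i , a) (j , b) with i ≟ᶠ j
  ... | yes refl = adj (G i) a b
  ... | no  _    = cycAdj k i j ∧ (does (a ≟ᶠ x i) ∧ does (b ≟ᶠ x j))

  Hcircuit : ℕ → ℕ
  Hcircuit = hosoya _≟ᶜ_ cverts cadj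

indexPairs : (k : ℕ) → List (Fin k × Fin k)
indexPairs k = pairs (allFin k)

module Submission where

-- The proof computes every distance of G:
--   * two vertices a, b of the same G_i are at distance d_{G_i}(a,b), and
--   * a ∈ G_i, b ∈ G_j (i < j) are at distance
--       d_{G_i}(a,x_i) + min(j-i, k-j+i) + d_{G_j}(x_j,b).
-- In both cases a walk of the claimed length is written down explicitly,
-- and the matching lower bound comes from a "potential" argument: a
-- function on vertices that grows by at most one along each edge and
-- vanishes at the source is a lower bound for the distance from it.
-- The Hosoya sum over all pairs of vertices of G then splits into the
-- pairs inside one block G_i, which give H(G_i,t), and the pairs across
-- two blocks G_i, G_j, whose sum factors as
--   t^{min(j-i,k-j+i)} (1 + H_{x_i}(G_i,t)) (1 + H_{x_j}(G_j,t)).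
-- (Blocks and cycle positions are indexed from 0, as in the definitions.)
-- The file first develops generic facts (Boolean bookkeeping, finite
-- sums and sums over pairs, walks and distances in finite graph data,
-- distances on a cycle), then the distances of the circuit, and finally
-- the theorem.

open import Defs hiding (sym)
open import Data.Bool using (Bool; true; false; _∧_; _∨_)
open import Data.Bool.Properties using (∧-comm; ∨-comm; ∨-zeroʳ; ∧-conicalˡ; ∧-conicalʳ; T-≡)
open import Data.Empty using (⊥-elim)
open import Data.Fin using (Fin; toℕ; fromℕ<)
open import Data.Fin.Properties using (toℕ-injective; toℕ<n; toℕ-fromℕ<) renaming (_≟_ to _≟ᶠ_)
open import Data.List using (List; []; _∷_; map; _++_; filter; length; allFin; concatMap)
open import Data.List.Properties using (length-++; map-++; map-cong; map-cong-local; map-∘; filter-all)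
open import Data.List.Membership.Propositional using (_∈_)
open import Data.List.Membership.Propositional.Properties using (∈-∃++; ∈-++⁻; ∈-allFin; ∈-++⁺ˡ; ∈-++⁺ʳ; ∈-map⁺; ∈-concat⁺′)
open import Data.List.Relation.Unary.Any using (here; there; any?)
import Data.List.Relation.Unary.Any as Any
open import Data.List.Relation.Unary.Any.Properties using (any⁺; any⁻)
open import Data.List.Relation.Unary.All using (All; [])
import Data.List.Relation.Unary.All as All
open import Data.List.Relation.Unary.All.Properties using (¬Any⇒All¬; ++⁺; map⁺)
open import Data.List.Relation.Unary.AllPairs using (AllPairs; []; _∷_)
open import Data.List.Relation.Unary.AllPairs.Properties using (tabulate⁺-<)
open import Data.List.Relation.Unary.Unique.Propositional using (Unique)
open import Data.List.Relation.Unary.Unique.Propositional.Properties using (allFin⁺)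
open import Data.Nat using (ℕ; zero; suc; _+_; _*_; _∸_; _^_; _≤_; _<_; _⊓_; z≤n; s≤s; z<s; _≡ᵇ_; ∣_-_∣)
open import Data.Nat.Properties
open import Data.Nat.Induction using (<-rec)
open import Data.Nat.ListAction using (sum)
open import Data.Nat.ListAction.Properties using (sum-++)
open import Data.Nat.Tactic.RingSolver using (solve-∀)
open import Data.Product using (_×_; _,_; ∃; proj₁; proj₂)
open import Data.Sum using (_⊎_; inj₁; inj₂)
open import Function using (_∘_; Equivalence)
open import Relation.Nullary using (yes; no; ¬_; ¬?; does; Dec; contradiction)
open import Relation.Nullary.Decidable using (dec-true)
open import Relation.Binary.PropositionalEquality
open import Relation.Binary.Definitions using (DecidableEquality)

∧-true : ∀ {a b} → a ≡ true → b ≡ true → a ∧ b ≡ true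
∧-true refl refl = refl

∧-true⁻ : ∀ a {b} → a ∧ b ≡ true → a ≡ true × b ≡ true
∧-true⁻ a {b} e = ∧-conicalˡ a b e , ∧-conicalʳ a b e

∨-trueˡ : ∀ {a} b → a ≡ true → a ∨ b ≡ true
∨-trueˡ b refl = refl

∨-trueʳ : ∀ a {b} → b ≡ true → a ∨ b ≡ true
∨-trueʳ a refl = ∨-zeroʳ a

∨-true⁻ : ∀ a {b} → a ∨ b ≡ true → a ≡ true ⊎ b ≡ true
∨-true⁻ true  _ = inj₁ refl
∨-true⁻ false e = inj₂ e

∨-swap : ∀ a b c d → a ∨ b ∨ c ∨ d ≡ b ∨ a ∨ d ∨ c
∨-swap true  true  c d = refl
∨-swap true  false c d = refl
∨-swap false true  c d = refl
∨-swap false false c d = ∨-comm c d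

≡ᵇ-true⁻ : ∀ {m n} → (m ≡ᵇ n) ≡ true → m ≡ n
≡ᵇ-true⁻ {m} {n} e = ≡ᵇ⇒≡ m n (Equivalence.from T-≡ e)

≡ᵇ-true : ∀ {m n} → m ≡ n → (m ≡ᵇ n) ≡ true
≡ᵇ-true {m} {n} e = Equivalence.to T-≡ (≡⇒≡ᵇ m n e)

does-true⁻ : ∀ {A : Set} {a b : A} (a≟b : Dec (a ≡ b)) → does a≟b ≡ true → a ≡ b
does-true⁻ (yes a≡b) _ = a≡b

unique-length-≤ : {A : Set} (xs ys : List A) → Unique xs → (∀ {z} → z ∈ xs → z ∈ ys) → length xs ≤ length ys
unique-length-≤ [] ys _ _ = z≤n
unique-length-≤ (z ∷ xs) ys (z∉xs ∷ uniq) xs⊆ys with ∈-∃++ (xs⊆ys (here refl))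
... | ys₁ , ys₂ , refl = begin
    suc (length xs)                ≤⟨ s≤s (unique-length-≤ xs (ys₁ ++ ys₂) uniq xs⊆ys₁ys₂) ⟩
    suc (length (ys₁ ++ ys₂))      ≡⟨ cong suc (length-++ ys₁) ⟩
    suc (length ys₁ + length ys₂)  ≡⟨ sym (+-suc (length ys₁) (length ys₂)) ⟩
    length ys₁ + length (z ∷ ys₂)  ≡⟨ sym (length-++ ys₁) ⟩
    length (ys₁ ++ z ∷ ys₂)        ∎
  where
  open ≤-Reasoning
  xs⊆ys₁ys₂ : ∀ {y} → y ∈ xs → y ∈ ys₁ ++ ys₂
  xs⊆ys₁ys₂ y∈xs with ∈-++⁻ ys₁ (xs⊆ys (there y∈xs))
  ... | inj₁ y∈ys₁         = ∈-++⁺ˡ y∈ys₁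
  ... | inj₂ (here refl)   = ⊥-elim (All.lookup z∉xs y∈xs refl)
  ... | inj₂ (there y∈ys₂) = ∈-++⁺ʳ ys₁ y∈ys₂

module _ {A : Set} where

  sum-map-++ : (f : A → ℕ) (xs ys : List A) → sum (map f (xs ++ ys)) ≡ sum (map f xs) + sum (map f ys)
  sum-map-++ f xs ys = trans (cong sum (map-++ f xs ys)) (sum-++ (map f xs) (map f ys))

  sum-map-+ : (f g : A → ℕ) (xs : List A) → sum (map (λ a → f a + g a) xs) ≡ sum (map f xs) + sum (map g xs)
  sum-map-+ f g []       = refl
  sum-map-+ f g (a ∷ xs) = trans (cong (f a + g a +_) (sum-map-+ f g xs)) (shuffle (f a) (g a) _ _)
    where
    shuffle : ∀ p q r s → (p + q) + (r + s) ≡ (p + r) + (q + s)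
    shuffle = solve-∀

  sum-map-*ˡ : (c : ℕ) (f : A → ℕ) (xs : List A) → sum (map (λ a → c * f a) xs) ≡ c * sum (map f xs)
  sum-map-*ˡ c f []       = sym (*-zeroʳ c)
  sum-map-*ˡ c f (a ∷ xs) = trans (cong (c * f a +_) (sum-map-*ˡ c f xs)) (sym (*-distribˡ-+ c (f a) _))

  sum-map-cong : {f g : A → ℕ} → (∀ a → f a ≡ g a) → (xs : List A) → sum (map f xs) ≡ sum (map g xs)
  sum-map-cong f≗g xs = cong sum (map-cong f≗g xs)

  sum-map-cong-local : {f g : A → ℕ} {xs : List A} → All (λ a → f a ≡ g a) xs → sum (map f xs) ≡ sum (map g xs)
  sum-map-cong-local f≗g = cong sum (map-cong-local f≗g)

  sum-map-zero : (xs : List A) → sum (map (λ _ → 0) xs) ≡ 0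
  sum-map-zero []       = refl
  sum-map-zero (_ ∷ xs) = sum-map-zero xs

  sum-map-remove : (_≟_ : DecidableEquality A) (f : A → ℕ) (xs : List A) (z : A) → Unique xs → z ∈ xs →
    sum (map f xs) ≡ f z + sum (map f (filter (λ a → ¬? (a ≟ z)) xs))
  sum-map-remove _≟_ f (a ∷ xs) z (a∉xs ∷ uniq) z∈a∷xs with a ≟ z | z∈a∷xs
  ... | yes refl | _ = cong (λ ys → f a + sum (map f ys)) (sym (filter-all (λ b → ¬? (b ≟ a)) (All.map (λ a≢b b≡a → a≢b (sym b≡a)) a∉xs)))
  ... | no a≢z | here z≡a = contradiction (sym z≡a) a≢z
  ... | no a≢z | there z∈xs = begin
      f a + sum (map f xs)                        ≡⟨ cong (f a +_) (sum-map-remove _≟_ f xs z uniq z∈xs) ⟩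
      f a + (f z + sum (map f (filter ≢z xs)))    ≡⟨ swap (f a) (f z) _ ⟩
      f z + (f a + sum (map f (filter ≢z xs)))    ∎
    where
    open ≡-Reasoning
    ≢z : (b : A) → Dec (¬ b ≡ z)
    ≢z b = ¬? (b ≟ z)
    swap : ∀ p q r → p + (q + r) ≡ q + (p + r)
    swap = solve-∀

sum-map-∘ : {A B : Set} (f : B → ℕ) (g : A → B) (xs : List A) → sum (map f (map g xs)) ≡ sum (map (f ∘ g) xs)
sum-map-∘ f g xs = cong sum (sym (map-∘ xs))

sum-map-product : {A B : Set} (c : ℕ) (f : A → ℕ) (g : B → ℕ) (xs : List A) (ys : List B) →
  sum (map (λ a → sum (map (λ b → c * f a * g b) ys)) xs) ≡ c * sum (map f xs) * sum (map g ys)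
sum-map-product c f g xs ys = begin
    sum (map (λ a → sum (map (λ b → c * f a * g b) ys)) xs)  ≡⟨ sum-map-cong (λ a → sum-map-*ˡ (c * f a) g ys) xs ⟩
    sum (map (λ a → c * f a * Σg) xs)                         ≡⟨ sum-map-cong (λ a → rearrange c (f a) Σg) xs ⟩
    sum (map (λ a → (c * Σg) * f a) xs)                       ≡⟨ sum-map-*ˡ (c * Σg) f xs ⟩
    (c * Σg) * sum (map f xs)                                 ≡⟨ rearrange c Σg _ ⟩
    c * sum (map f xs) * Σg                                   ∎
  where
  open ≡-Reasoning
  Σg : ℕ
  Σg = sum (map g ys)
  rearrange : ∀ p q r → p * q * r ≡ p * r * q
  rearrange = solve-∀

-- Sums over the 2-element subsets  pairs xs  of a list.  Splitting the
-- list into blocks splits such a sum into the pairs inside each block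
-- and the "cross" pairs between two blocks.

both : {A B : Set} → (A → B) → A × A → B × B
both g (a , b) = g a , g b

pairs-map : {A B : Set} (g : A → B) (xs : List A) → pairs (map g xs) ≡ map (both g) (pairs xs)
pairs-map g []       = refl
pairs-map g (a ∷ xs) = begin
    map (g a ,_) (map g xs) ++ pairs (map g xs)            ≡⟨ cong₂ _++_ (sym (map-∘ xs)) (pairs-map g xs) ⟩
    map (both g ∘ (a ,_)) xs ++ map (both g) (pairs xs)    ≡⟨ cong (_++ map (both g) (pairs xs)) (map-∘ xs) ⟩
    map (both g) (map (a ,_) xs) ++ map (both g) (pairs xs) ≡⟨ sym (map-++ (both g) (map (a ,_) xs) (pairs xs)) ⟩
    map (both g) (map (a ,_) xs ++ pairs xs)               ∎
  where open ≡-Reasoning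

pairs-AllPairs : {A : Set} {R : A → A → Set} {xs : List A} → AllPairs R xs → All (λ p → R (proj₁ p) (proj₂ p)) (pairs xs)
pairs-AllPairs []                  = []
pairs-AllPairs {xs = a ∷ xs} (a~xs ∷ rest) = ++⁺ (map⁺ a~xs) (pairs-AllPairs rest)

module _ {A : Set} (f : A × A → ℕ) where

  crossSum : List A → List A → ℕ
  crossSum xs ys = sum (map (λ a → sum (map (λ b → f (a , b)) ys)) xs)

  crossSum-map : {I J : Set} (g : I → A) (h : J → A) (is : List I) (js : List J) →
    crossSum (map g is) (map h js) ≡ sum (map (λ i → sum (map (λ j → f (g i , h j)) js)) is)
  crossSum-map g h is js = trans (sum-map-∘ _ g is) (sum-map-cong (λ i → sum-map-∘ _ h js) is)

  crossSum-++ʳ : (xs ys zs : List A) → crossSum xs (ys ++ zs) ≡ crossSum xs ys + crossSum xs zs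
  crossSum-++ʳ xs ys zs = trans (sum-map-cong (λ a → sum-map-++ (λ b → f (a , b)) ys zs) xs)
                                (sum-map-+ (λ a → sum (map (λ b → f (a , b)) ys)) (λ a → sum (map (λ b → f (a , b)) zs)) xs)

  sum-pairs-++ : (xs ys : List A) →
    sum (map f (pairs (xs ++ ys))) ≡ sum (map f (pairs xs)) + sum (map f (pairs ys)) + crossSum xs ys
  sum-pairs-++ []       ys = sym (+-identityʳ _)
  sum-pairs-++ (a ∷ xs) ys = begin
      sum (map f (map (a ,_) (xs ++ ys) ++ pairs (xs ++ ys)))
    ≡⟨ sum-map-++ f (map (a ,_) (xs ++ ys)) (pairs (xs ++ ys)) ⟩
      sum (map f (map (a ,_) (xs ++ ys))) + sum (map f (pairs (xs ++ ys)))
    ≡⟨ cong₂ _+_ (trans (cong (sum ∘ map f) (map-++ (a ,_) xs ys)) (sum-map-++ f (map (a ,_) xs) (map (a ,_) ys)))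
                 (sum-pairs-++ xs ys) ⟩
      (ax + ay) + (sum (map f (pairs xs)) + sum (map f (pairs ys)) + crossSum xs ys)
    ≡⟨ regroup ax ay (sum (map f (pairs xs))) (sum (map f (pairs ys))) (crossSum xs ys) ⟩
      (ax + sum (map f (pairs xs))) + sum (map f (pairs ys)) + (ay + crossSum xs ys)
    ≡⟨ cong₂ (λ p q → p + sum (map f (pairs ys)) + (q + crossSum xs ys))
             (sym (sum-map-++ f (map (a ,_) xs) (pairs xs))) (sum-map-∘ f (a ,_) ys) ⟩
      sum (map f (pairs (a ∷ xs))) + sum (map f (pairs ys)) + crossSum (a ∷ xs) ys
    ∎
    where
    open ≡-Reasoning
    ax ay : ℕ
    ax = sum (map f (map (a ,_) xs))
    ay = sum (map f (map (a ,_) ys))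
    regroup : ∀ p q r s u → (p + q) + (r + s + u) ≡ (p + r) + s + (q + u)
    regroup = solve-∀

  module _ {I : Set} (block : I → List A) where

    crossSum-concatMap : (xs : List A) (is : List I) →
      crossSum xs (concatMap block is) ≡ sum (map (λ j → crossSum xs (block j)) is)
    crossSum-concatMap xs []       = trans (sum-map-cong (λ _ → refl) xs) (sum-map-zero xs)
    crossSum-concatMap xs (i ∷ is) = trans (crossSum-++ʳ xs (block i) (concatMap block is))
                                           (cong (crossSum xs (block i) +_) (crossSum-concatMap xs is))

    sum-pairs-concatMap : (is : List I) →
      sum (map f (pairs (concatMap block is)))
        ≡ sum (map (λ i → sum (map f (pairs (block i)))) is)
          + sum (map (λ { (i , j) → crossSum (block i) (block j) }) (pairs is))
    sum-pairs-concatMap []       = refl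
    sum-pairs-concatMap (i ∷ is) = begin
        sum (map f (pairs (block i ++ concatMap block is)))
      ≡⟨ sum-pairs-++ (block i) (concatMap block is) ⟩
        inner i + sum (map f (pairs (concatMap block is))) + crossSum (block i) (concatMap block is)
      ≡⟨ cong₂ (λ p q → inner i + p + q) (sum-pairs-concatMap is) (crossSum-concatMap (block i) is) ⟩
        inner i + (sum (map inner is) + sum (map cross (pairs is))) + sum (map (λ j → cross (i , j)) is)
      ≡⟨ regroup (inner i) (sum (map inner is)) _ _ ⟩
        inner i + sum (map inner is) + (sum (map (λ j → cross (i , j)) is) + sum (map cross (pairs is)))
      ≡⟨ cong (inner i + sum (map inner is) +_)
              (trans (cong (_+ sum (map cross (pairs is))) (sym (sum-map-∘ cross (i ,_) is)))
                     (sym (sum-map-++ cross (map (i ,_) is) (pairs is)))) ⟩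
        sum (map inner (i ∷ is)) + sum (map cross (pairs (i ∷ is)))
      ∎
      where
      open ≡-Reasoning
      inner : I → ℕ
      inner i = sum (map f (pairs (block i)))
      cross : I × I → ℕ
      cross (i , j) = crossSum (block i) (block j)
      regroup : ∀ p q r s → p + (q + r) + s ≡ p + q + (s + r)
      regroup = solve-∀

-- Walks and distances in finite graph data (vertex type V, a list vs
-- containing every vertex, Boolean adjacency adj).

module Walks {V : Set} (_≟_ : DecidableEquality V) (vs : List V) (adj : V → V → Bool)
             (complete : ∀ v → v ∈ vs) where

  R : ℕ → V → V → Bool
  R = reach _≟_ vs adj

  δ : V → V → ℕ
  δ = dist _≟_ vs adj

  data Walk : ℕ → V → V → Set where
    stop : ∀ {u} → Walk 0 u u
    step : ∀ {m u w v} → Walk m u w → adj w v ≡ true → Walk (suc m) u v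

  walk⇒reach : ∀ {m u v} → Walk m u v → R m u v ≡ true
  walk⇒reach {u = u} stop = dec-true (u ≟ u) refl
  walk⇒reach {suc m} {u} {v} (step {w = w} W e) =
    Equivalence.to T-≡ (any⁺ (λ y → R m u y ∧ adj y v)
      (Any.map (λ { refl → Equivalence.from T-≡ (∧-true (walk⇒reach W) e) }) (complete w)))

  reach⇒walk : ∀ m u v → R m u v ≡ true → Walk m u v
  reach⇒walk zero u v e with u ≟ v
  ... | yes refl = stop
  reach⇒walk zero u v () | no _
  reach⇒walk (suc m) u v e with Any.satisfied (any⁻ (λ y → R m u y ∧ adj y v) vs (Equivalence.from T-≡ e))
  ... | w , hit with ∧-true⁻ (R m u w) (Equivalence.to T-≡ hit)
  ... | u↝w , w~v = step (reach⇒walk m u w u↝w) w~v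

  departures : ∀ {m u v} → Walk m u v → List V
  departures stop                 = []
  departures (step {w = w} W _) = w ∷ departures W

  length-departures : ∀ {m u v} (W : Walk m u v) → length (departures W) ≡ m
  length-departures stop       = refl
  length-departures (step W _) = cong suc (length-departures W)

  truncate : ∀ {m u v z} (W : Walk m u v) → z ∈ departures W → ∃ λ p → p < m × Walk p u z
  truncate (step W _) (here refl) = _ , ≤-refl , W
  truncate (step W _) (there z∈) with truncate W z∈
  ... | p , p<m , W′ = p , m<n⇒m<1+n p<m , W′

  unique-or-shorter : ∀ {m u v} (W : Walk m u v) → Unique (departures W) ⊎ ∃ λ m′ → m′ < m × Walk m′ u v
  unique-or-shorter stop = inj₁ []
  unique-or-shorter (step {w = w} W e) with unique-or-shorter W
  ... | inj₂ (m′ , m′<m , W′) = inj₂ (suc m′ , s≤s m′<m , step W′ e)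
  ... | inj₁ uniq with any? (w ≟_) (departures W)
  ...   | yes w∈ = let (p , p<m , W′) = truncate W w∈ in inj₂ (suc p , s≤s p<m , step W′ e)
  ...   | no  w∉ = inj₁ (¬Any⇒All¬ (departures W) w∉ ∷ uniq)

  shortWalk : ∀ {m u v} → Walk m u v → ∃ λ m′ → m′ ≤ length vs × Walk m′ u v
  shortWalk {m} = <-rec P shorten m
    where
    P : ℕ → Set
    P m = ∀ {u v} → Walk m u v → ∃ λ m′ → m′ ≤ length vs × Walk m′ u v
    shorten : ∀ m → (∀ {m′} → m′ < m → P m′) → P m
    shorten m rec W with unique-or-shorter W
    ... | inj₁ uniq = m , subst (_≤ length vs) (length-departures W) (unique-length-≤ _ vs uniq (λ {y} _ → complete y)) , W
    ... | inj₂ (m′ , m′<m , W′) = rec m′<m W′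

  leastTrue-≤ : ∀ f b m → f m ≡ true → leastTrue _≟_ vs adj f b ≤ m
  leastTrue-≤ f zero    m       _ = z≤n
  leastTrue-≤ f (suc b) zero    e rewrite e = z≤n
  leastTrue-≤ f (suc b) (suc m) e with f zero
  ... | true  = z≤n
  ... | false = s≤s (leastTrue-≤ (f ∘ suc) b m e)

  leastTrue-hit : ∀ f b → f (leastTrue _≟_ vs adj f b) ≡ true
                  ⊎ (leastTrue _≟_ vs adj f b ≡ b × (∀ m → m < b → f m ≡ false))
  leastTrue-hit f zero = inj₂ (refl , λ _ ())
  leastTrue-hit f (suc b) with f zero in f0
  ... | true  = inj₁ f0
  ... | false with leastTrue-hit (f ∘ suc) b
  ...   | inj₁ hit           = inj₁ hit
  ...   | inj₂ (atB , misses) = inj₂ (cong suc atB , λ { zero _ → f0 ; (suc m) (s≤s m<b) → misses m m<b })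

  δ-≤ : ∀ {m u v} → Walk m u v → δ u v ≤ m
  δ-≤ {m} {u} {v} W = leastTrue-≤ (λ l → R l u v) (length vs) m (walk⇒reach W)

  geodesic : ∀ {m u v} → Walk m u v → Walk (δ u v) u v
  geodesic {u = u} {v} W with leastTrue-hit (λ l → R l u v) (length vs)
  ... | inj₁ hit = reach⇒walk _ u v hit
  ... | inj₂ (atBound , misses) with shortWalk W
  ...   | m′ , m′≤L , W′ with m≤n⇒m<n∨m≡n m′≤L
  ...     | inj₁ m′<L = contradiction (trans (sym (misses m′ m′<L)) (walk⇒reach W′)) λ ()
  ...     | inj₂ refl = subst (λ l → Walk l u v) (sym atBound) W′

  _++ʷ_ : ∀ {m l u w v} → Walk m u w → Walk l w v → Walk (l + m) u v
  W ++ʷ stop      = W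
  W ++ʷ step W′ e = step (W ++ʷ W′) e

  potential-≤ : (φ : V → ℕ) → (∀ w v → adj w v ≡ true → φ v ≤ suc (φ w)) →
                ∀ {m u v} → Walk m u v → φ v ≤ m + φ u
  potential-≤ φ lip stop = ≤-refl
  potential-≤ φ lip (step {w = w} {v = v} W e) = ≤-trans (lip w v e) (s≤s (potential-≤ φ lip W))

  potential-≤-δ : (φ : V → ℕ) → (∀ w v → adj w v ≡ true → φ v ≤ suc (φ w)) →
                  ∀ {m u v} → Walk m u v → φ v ≤ δ u v + φ u
  potential-≤-δ φ lip W = potential-≤ φ lip (geodesic W)

  module Symmetric (adj-sym : ∀ u v → adj u v ≡ adj v u) where

    prepend : ∀ {m u w v} → adj u w ≡ true → Walk m w v → Walk (suc m) u v
    prepend e stop         = step stop e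
    prepend e (step W e′) = step (prepend e W) e′

    reverse : ∀ {m u v} → Walk m u v → Walk m v u
    reverse stop                          = stop
    reverse (step {w = w} {v = v} W e) = prepend (trans (adj-sym v w) e) (reverse W)

    δ-sym : ∀ {m u v} → Walk m u v → δ u v ≡ δ v u
    δ-sym W = ≤-antisym (δ-≤ (reverse (geodesic (reverse W)))) (δ-≤ (reverse (geodesic W)))

module ConnectedGraph {n : ℕ} (G : Graph n) (conn : Connected G) where

  open Walks _≟ᶠ_ (allFin n) (adj G) ∈-allFin public

  shortest : ∀ a b → Walk (d G a b) a b
  shortest a b = let (m , e) = conn a b in geodesic (reach⇒walk m a b e)

  d-self : ∀ a → d G a a ≡ 0
  d-self a = n≤0⇒n≡0 (δ-≤ stop)

  d-edge : ∀ a w v → adj G w v ≡ true → d G a v ≤ suc (d G a w)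
  d-edge a w v e = δ-≤ (step (shortest a w) e)

  d-sym : ∀ a b → d G a b ≡ d G b a
  d-sym a b = Symmetric.δ-sym (Graph.sym G) (shortest a b)

  -- Σ_b t^{d(a,b)} = 1 + H_a(G,t): the term b = a contributes t⁰ = 1.
  sum-powers-d : ∀ a t → sum (map (λ b → t ^ d G a b) (allFin n)) ≡ 1 + Hpart G a t
  sum-powers-d a t = trans (sum-map-remove _≟ᶠ_ (λ b → t ^ d G a b) (allFin n) a (allFin⁺ n) (∈-allFin a))
                           (cong (λ l → t ^ l + Hpart G a t) (d-self a))

module CyclicDistance (k : ℕ) where

  cdist : ℕ → ℕ → ℕ
  cdist p q = ∣ p - q ∣ ⊓ (k ∸ ∣ p - q ∣)

  cdist-self : ∀ p → cdist p p ≡ 0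
  cdist-self p rewrite ∣n-n∣≡0 p = refl

  cdist-≤ : ∀ p q → p ≤ q → q ≤ k → cdist p q ≡ (q ∸ p) ⊓ (k ∸ q + p)
  cdist-≤ p q p≤q q≤k rewrite m≤n⇒∣m-n∣≡n∸m p≤q = cong ((q ∸ p) ⊓_) k∸[q∸p]
    where
    k∸[q∸p] : k ∸ (q ∸ p) ≡ k ∸ q + p
    k∸[q∸p] = begin
      k ∸ (q ∸ p)                      ≡⟨ cong (_∸ (q ∸ p)) (sym k≡) ⟩
      (k ∸ q + p) + (q ∸ p) ∸ (q ∸ p)  ≡⟨ m+n∸n≡m (k ∸ q + p) (q ∸ p) ⟩
      k ∸ q + p                        ∎
      where
      open ≡-Reasoning
      k≡ : (k ∸ q + p) + (q ∸ p) ≡ k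
      k≡ = trans (+-assoc (k ∸ q) p (q ∸ p))
                 (trans (cong (k ∸ q +_) (trans (+-comm p (q ∸ p)) (m∸n+n≡m p≤q))) (m∸n+n≡m q≤k))

  k∸-step : ∀ {d₁ d₂} → d₁ ≤ suc d₂ → d₁ ≤ k → k ∸ d₂ ≤ suc (k ∸ d₁)
  k∸-step {d₁} {d₂} d₁≤ d₁≤k = m≤n+o⇒m∸n≤o k d₂ (begin
      k                    ≡⟨ sym (m∸n+n≡m d₁≤k) ⟩
      (k ∸ d₁) + d₁        ≤⟨ +-monoʳ-≤ (k ∸ d₁) d₁≤ ⟩
      (k ∸ d₁) + suc d₂    ≡⟨ +-suc (k ∸ d₁) d₂ ⟩
      suc ((k ∸ d₁) + d₂)  ≡⟨ cong suc (+-comm (k ∸ d₁) d₂) ⟩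
      suc (d₂ + (k ∸ d₁))  ≡⟨ sym (+-suc d₂ (k ∸ d₁)) ⟩
      d₂ + suc (k ∸ d₁)    ∎)
    where open ≤-Reasoning

  cdist-step : ∀ p q r → p < k → q < k → ∣ q - r ∣ ≡ 1 → cdist p r ≤ suc (cdist p q)
  cdist-step p q r p<k q<k ∣q-r∣≡1 = ⊓-mono-≤ ∣p-r∣≤ (k∸-step ∣p-q∣≤ ∣p-q∣≤k)
    where
    ∣p-r∣≤ : ∣ p - r ∣ ≤ suc ∣ p - q ∣
    ∣p-r∣≤ = subst (∣ p - r ∣ ≤_) (trans (cong (∣ p - q ∣ +_) ∣q-r∣≡1) (+-comm ∣ p - q ∣ 1)) (∣-∣-triangle p q r)
    ∣p-q∣≤ : ∣ p - q ∣ ≤ suc ∣ p - r ∣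
    ∣p-q∣≤ = subst (∣ p - q ∣ ≤_)
               (trans (cong (∣ p - r ∣ +_) (trans (∣-∣-comm r q) ∣q-r∣≡1)) (+-comm ∣ p - r ∣ 1)) (∣-∣-triangle p r q)
    ∣p-q∣≤k : ∣ p - q ∣ ≤ k
    ∣p-q∣≤k = ≤-trans (∣m-n∣≤m⊔n p q) (<⇒≤ (⊔-lub p<k q<k))

  ⊓-cross-mono : ∀ {a b a′ b′} → a′ ≤ suc b → b′ ≤ suc a → a′ ⊓ b′ ≤ suc (a ⊓ b)
  ⊓-cross-mono {a} {b} a′≤ b′≤ = subst (λ z → _ ≤ suc z) (⊓-comm b a) (⊓-mono-≤ a′≤ b′≤)

  suc-r∸[r∸p] : ∀ {p r} → p ≤ r → suc r ∸ (r ∸ p) ≡ suc p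
  suc-r∸[r∸p] {p} {r} p≤r = trans (+-∸-assoc 1 (m∸n≤m r p)) (cong suc (m∸[m∸n]≡n p≤r))

  -- the closing edge, traversed from 0 to k-1 and from k-1 to 0
  cdist-close : ∀ p r → p < k → suc r ≡ k → cdist p r ≤ suc (cdist p 0)
  cdist-close p r p<k refl rewrite ∣-∣-identityʳ p | m≤n⇒∣m-n∣≡n∸m (≤-pred p<k) =
    ⊓-cross-mono (≤-trans (∸-monoˡ-≤ p (n≤1+n r)) (n≤1+n _)) (≤-reflexive (suc-r∸[r∸p] (≤-pred p<k)))

  cdist-open : ∀ p q → p < k → suc q ≡ k → cdist p 0 ≤ suc (cdist p q)
  cdist-open p q p<k refl rewrite ∣-∣-identityʳ p | m≤n⇒∣m-n∣≡n∸m (≤-pred p<k) | suc-r∸[r∸p] (≤-pred p<k) =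
    ⊓-cross-mono (≤-trans (n≤1+n p) (n≤1+n _)) (≤-reflexive (+-∸-assoc 1 (≤-pred p<k)))

∣n-1+n∣≡1 : ∀ q → ∣ q - suc q ∣ ≡ 1
∣n-1+n∣≡1 zero    = refl
∣n-1+n∣≡1 (suc q) = ∣n-1+n∣≡1 q

∸-suc : ∀ k q → q < k → k ∸ q ≡ suc (k ∸ suc q)
∸-suc (suc k) zero    _         = refl
∸-suc (suc k) (suc q) (s≤s q<k) = ∸-suc k q q<k

-- Distances in the circuit of G₀,…,G_{k-1} (k ≥ 2, so that the closing
-- edge of the cycle is not a loop) with respect to x₀,…,x_{k-1}.
module CircuitDistance (k : ℕ) (2≤k : 2 ≤ k) (n : Fin k → ℕ) (G : (i : Fin k) → Graph (n i))
                       (conn : ∀ i → Connected (G i)) (x : (i : Fin k) → Fin (n i)) where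

  open Circuit k n G x
  open CyclicDistance k
  module Block (i : Fin k) = ConnectedGraph (G i) (conn i)

  pos : Fin k → ℕ
  pos = toℕ

  arc : Fin k → Fin k → ℕ
  arc i j = (pos j ∸ pos i) ⊓ (k ∸ pos j + pos i)

  cycAdj-sym : ∀ i j → cycAdj k i j ≡ cycAdj k j i
  cycAdj-sym i j = ∨-swap (pos j ≡ᵇ suc (pos i)) (pos i ≡ᵇ suc (pos j)) ((pos i ≡ᵇ 0) ∧ (suc (pos j) ≡ᵇ k)) ((pos j ≡ᵇ 0) ∧ (suc (pos i) ≡ᵇ k))

  cycAdj-cases : ∀ i j → cycAdj k i j ≡ true →
    pos j ≡ suc (pos i) ⊎ pos i ≡ suc (pos j) ⊎ (pos i ≡ 0 × suc (pos j) ≡ k) ⊎ (pos j ≡ 0 × suc (pos i) ≡ k)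
  cycAdj-cases i j e with ∨-true⁻ (pos j ≡ᵇ suc (pos i)) e
  ... | inj₁ fwd = inj₁ (≡ᵇ-true⁻ fwd)
  ... | inj₂ e₁ with ∨-true⁻ (pos i ≡ᵇ suc (pos j)) e₁
  ...   | inj₁ bwd = inj₂ (inj₁ (≡ᵇ-true⁻ bwd))
  ...   | inj₂ e₂ with ∨-true⁻ ((pos i ≡ᵇ 0) ∧ (suc (pos j) ≡ᵇ k)) e₂
  ...     | inj₁ cls = let (i≡0 , j≡k-1) = ∧-true⁻ (pos i ≡ᵇ 0) cls in inj₂ (inj₂ (inj₁ (≡ᵇ-true⁻ i≡0 , ≡ᵇ-true⁻ j≡k-1)))
  ...     | inj₂ opn = let (j≡0 , i≡k-1) = ∧-true⁻ (pos j ≡ᵇ 0) opn in inj₂ (inj₂ (inj₂ (≡ᵇ-true⁻ j≡0 , ≡ᵇ-true⁻ i≡k-1)))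

  cdist-cycAdj : ∀ p j l → p < k → cycAdj k j l ≡ true → cdist p (pos l) ≤ suc (cdist p (pos j))
  cdist-cycAdj p j l p<k e with cycAdj-cases j l e
  ... | inj₁ l≡1+j = cdist-step p (pos j) (pos l) p<k (toℕ<n j) (subst (λ z → ∣ pos j - z ∣ ≡ 1) (sym l≡1+j) (∣n-1+n∣≡1 (pos j)))
  ... | inj₂ (inj₁ j≡1+l) = cdist-step p (pos j) (pos l) p<k (toℕ<n j)
          (subst (λ z → ∣ z - pos l ∣ ≡ 1) (sym j≡1+l) (trans (∣-∣-comm (suc (pos l)) (pos l)) (∣n-1+n∣≡1 (pos l))))
  ... | inj₂ (inj₂ (inj₁ (j≡0 , l≡k-1))) rewrite j≡0 = cdist-close p (pos l) p<k l≡k-1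
  ... | inj₂ (inj₂ (inj₂ (l≡0 , j≡k-1))) rewrite l≡0 = cdist-open p (pos j) p<k j≡k-1

  cverts-complete : ∀ v → v ∈ cverts
  cverts-complete (i , a) = ∈-concat⁺′ (∈-map⁺ (i ,_) (∈-allFin a)) (∈-map⁺ (λ j → map (j ,_) (allFin (n j))) (∈-allFin i))

  cadj-within : ∀ i a b → cadj (i , a) (i , b) ≡ adj (G i) a b
  cadj-within i a b with i ≟ᶠ i
  ... | yes refl = refl
  ... | no i≢i   = contradiction refl i≢i

  cadj-sym : ∀ u v → cadj u v ≡ cadj v u
  cadj-sym (i , a) (j , b) with i ≟ᶠ j | j ≟ᶠ i
  ... | yes refl | yes refl = Graph.sym (G i) a b
  ... | yes refl | no i≢i   = contradiction refl i≢i
  ... | no j≢j   | yes refl = contradiction refl j≢j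
  ... | no _     | no _     = cong₂ _∧_ (cycAdj-sym i j) (∧-comm (does (a ≟ᶠ x i)) _)

  open Walks _≟ᶜ_ cverts cadj cverts-complete
  open Symmetric cadj-sym using (reverse)

  hub : Fin k → CV
  hub i = i , x i

  hub-edge : ∀ i j → i ≢ j → cycAdj k i j ≡ true → cadj (hub i) (hub j) ≡ true
  hub-edge i j i≢j e with i ≟ᶠ j
  ... | yes i≡j = contradiction i≡j i≢j
  ... | no _    = ∧-true e (∧-true (dec-true (x i ≟ᶠ x i) refl) (dec-true (x j ≟ᶠ x j) refl))

  hub-edge⁻ : ∀ j l b b′ → cycAdj k j l ∧ (does (b ≟ᶠ x j) ∧ does (b′ ≟ᶠ x l)) ≡ true →
              cycAdj k j l ≡ true × b ≡ x j × b′ ≡ x l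
  hub-edge⁻ j l b b′ e =
    let (c , e′) = ∧-true⁻ (cycAdj k j l) e
        (b≡ , b′≡) = ∧-true⁻ (does (b ≟ᶠ x j)) e′
    in c , does-true⁻ (b ≟ᶠ x j) b≡ , does-true⁻ (b′ ≟ᶠ x l) b′≡

  hub-forward : ∀ i j → pos j ≡ suc (pos i) → cadj (hub i) (hub j) ≡ true
  hub-forward i j j≡1+i = hub-edge i j (λ i≡j → 1+n≢n (trans (sym j≡1+i) (cong pos (sym i≡j)))) (∨-trueˡ _ (≡ᵇ-true j≡1+i))

  hub-close : ∀ i j → pos i ≡ 0 → suc (pos j) ≡ k → cadj (hub i) (hub j) ≡ true
  hub-close i j i≡0 j≡k-1 = hub-edge i j i≢j
    (∨-trueʳ (pos j ≡ᵇ suc (pos i)) (∨-trueʳ (pos i ≡ᵇ suc (pos j)) (∨-trueˡ ((pos j ≡ᵇ 0) ∧ (suc (pos i) ≡ᵇ k)) (∧-true (≡ᵇ-true i≡0) (≡ᵇ-true j≡k-1)))))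
    where
    i≢j : i ≢ j
    i≢j refl = <⇒≢ 2≤k (sym (trans (sym j≡k-1) (cong suc i≡0)))

  lift : ∀ {i m a b} → Block.Walk i m a b → Walk m (i , a) (i , b)
  lift Block.stop                = stop
  lift {i} (Block.step {w = w} {v = v} W e) = step (lift W) (trans (cadj-within i w v) e)

  forwardWalk : ∀ l (i j : Fin k) → pos j ≡ l + pos i → Walk l (hub i) (hub j)
  forwardWalk zero    i j j≡i = subst (λ z → Walk 0 (hub i) (hub z)) (toℕ-injective (sym j≡i)) stop
  forwardWalk (suc l) i j j≡ = step (forwardWalk l i j′ (toℕ-fromℕ< j′<k)) (hub-forward j′ j j≡1+j′)
    where
    j′<k : l + pos i < k
    j′<k = <-trans (n<1+n _) (subst (_< k) j≡ (toℕ<n j))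
    j′ : Fin k
    j′ = fromℕ< j′<k
    j≡1+j′ : pos j ≡ suc (pos j′)
    j≡1+j′ = trans j≡ (cong suc (sym (toℕ-fromℕ< j′<k)))

  arcWalk : ∀ i j → pos i ≤ pos j → Walk (arc i j) (hub i) (hub j)
  arcWalk i j i≤j with ⊓-sel (pos j ∸ pos i) (k ∸ pos j + pos i)
  ... | inj₁ arc≡direct = subst (λ l → Walk l (hub i) (hub j)) (sym arc≡direct)
                                (forwardWalk _ i j (sym (m∸n+n≡m i≤j)))
  ... | inj₂ arc≡around = subst (λ l → Walk l (hub i) (hub j)) (sym (trans arc≡around length-around)) around
    where
    p q : ℕ
    p = pos i
    q = pos j
    0<k : 0 < k
    0<k = <-trans z<s 2≤k
    first : Fin k
    first = fromℕ< 0<k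
    1+last≡k : suc ((k ∸ suc q) + q) ≡ k
    1+last≡k = trans (sym (+-suc (k ∸ suc q) q)) (m∸n+n≡m (toℕ<n j))
    last<k : (k ∸ suc q) + q < k
    last<k = ≤-reflexive 1+last≡k
    last : Fin k
    last = fromℕ< last<k
    -- back from c_i to c_0, across the closing edge to c_{k-1}, back to c_j
    around : Walk ((k ∸ suc q) + (1 + p)) (hub i) (hub j)
    around = (reverse (forwardWalk p first i (trans (sym (+-identityʳ p)) (cong (p +_) (sym (toℕ-fromℕ< 0<k)))))
               ++ʷ step stop (hub-close first last (toℕ-fromℕ< 0<k) (trans (cong suc (toℕ-fromℕ< last<k)) 1+last≡k)))
             ++ʷ reverse (forwardWalk (k ∸ suc q) j last (toℕ-fromℕ< last<k))
    length-around : k ∸ q + p ≡ (k ∸ suc q) + (1 + p)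
    length-around = trans (cong (_+ p) (∸-suc k q (toℕ<n j))) (sym (+-suc (k ∸ suc q) p))

  -- The claimed distances from a source vertex (i , a), as a potential:
  -- φ vanishes at the source and grows by at most one along every edge,
  -- so it is a lower bound for the circuit distance from (i , a).
  module FromSource (i : Fin k) (a : Fin (n i)) where

    A : ℕ
    A = d (G i) a (x i)

    φ : CV → ℕ
    φ (j , b) with j ≟ᶠ i
    ... | yes refl = d (G i) a b
    ... | no  _    = A + cdist (pos i) (pos j) + d (G j) (x j) b

    φ-home : ∀ b → φ (i , b) ≡ d (G i) a b
    φ-home b with i ≟ᶠ i
    ... | yes refl = refl
    ... | no i≢i   = contradiction refl i≢i

    φ-away : ∀ j b → j ≢ i → φ (j , b) ≡ A + cdist (pos i) (pos j) + d (G j) (x j) b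
    φ-away j b j≢i with j ≟ᶠ i
    ... | yes j≡i = contradiction j≡i j≢i
    ... | no _    = refl

    φ-hub : ∀ j → j ≢ i → φ (hub j) ≡ A + cdist (pos i) (pos j)
    φ-hub j j≢i = trans (φ-away j (x j) j≢i) (trans (cong (A + cdist (pos i) (pos j) +_) (Block.d-self j (x j))) (+-identityʳ _))

    open ≤-Reasoning

    φ-edge-block : ∀ j b b′ → Dec (j ≡ i) → adj (G j) b b′ ≡ true → φ (j , b′) ≤ suc (φ (j , b))
    φ-edge-block j b b′ (yes refl) e = begin
      φ (i , b′)         ≡⟨ φ-home b′ ⟩
      d (G i) a b′       ≤⟨ Block.d-edge i a b b′ e ⟩
      suc (d (G i) a b)  ≡⟨ cong suc (sym (φ-home b)) ⟩
      suc (φ (i , b))    ∎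
    φ-edge-block j b b′ (no j≢i) e = begin
      φ (j , b′)                        ≡⟨ φ-away j b′ j≢i ⟩
      A + c + d (G j) (x j) b′          ≤⟨ +-monoʳ-≤ (A + c) (Block.d-edge j (x j) b b′ e) ⟩
      A + c + suc (d (G j) (x j) b)     ≡⟨ +-suc (A + c) _ ⟩
      suc (A + c + d (G j) (x j) b)     ≡⟨ cong suc (sym (φ-away j b j≢i)) ⟩
      suc (φ (j , b))                   ∎
      where
      c : ℕ
      c = cdist (pos i) (pos j)

    φ-edge-cycle : ∀ j l → j ≢ l → Dec (j ≡ i) → Dec (l ≡ i) → cycAdj k j l ≡ true → φ (hub l) ≤ suc (φ (hub j))
    φ-edge-cycle j l j≢l (yes refl) (yes refl) _ = contradiction refl j≢l
    φ-edge-cycle j l j≢l (yes refl) (no l≢i) e = begin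
      φ (hub l)                  ≡⟨ φ-hub l l≢i ⟩
      A + cdist (pos i) (pos l)  ≤⟨ +-monoʳ-≤ A (subst (λ z → cdist (pos i) (pos l) ≤ suc z) (cdist-self (pos i))
                                                       (cdist-cycAdj (pos i) i l (toℕ<n i) e)) ⟩
      A + 1                      ≡⟨ +-comm A 1 ⟩
      suc A                      ≡⟨ cong suc (sym (φ-home (x i))) ⟩
      suc (φ (hub i))            ∎
    φ-edge-cycle j l j≢l (no j≢i) (yes refl) _ = begin
      φ (hub i)                        ≡⟨ φ-home (x i) ⟩
      A                                ≤⟨ m≤m+n A _ ⟩
      A + cdist (pos i) (pos j)        ≤⟨ n≤1+n _ ⟩
      suc (A + cdist (pos i) (pos j))  ≡⟨ cong suc (sym (φ-hub j j≢i)) ⟩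
      suc (φ (hub j))                  ∎
    φ-edge-cycle j l j≢l (no j≢i) (no l≢i) e = begin
      φ (hub l)                        ≡⟨ φ-hub l l≢i ⟩
      A + cdist (pos i) (pos l)        ≤⟨ +-monoʳ-≤ A (cdist-cycAdj (pos i) j l (toℕ<n i) e) ⟩
      A + suc (cdist (pos i) (pos j))  ≡⟨ +-suc A _ ⟩
      suc (A + cdist (pos i) (pos j))  ≡⟨ cong suc (sym (φ-hub j j≢i)) ⟩
      suc (φ (hub j))                  ∎

    φ-edge : ∀ u v → cadj u v ≡ true → φ v ≤ suc (φ u)
    φ-edge (j , b) (l , b′) e with j ≟ᶠ l
    ... | yes refl = φ-edge-block j b b′ (j ≟ᶠ i) e
    ... | no j≢l with hub-edge⁻ j l b b′ e
    ...   | c , refl , refl = φ-edge-cycle j l j≢l (j ≟ᶠ i) (l ≟ᶠ i) c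

    φ-≤-δ : ∀ {m} v → Walk m (i , a) v → φ v ≤ δ (i , a) v
    φ-≤-δ v W = subst (φ v ≤_) (trans (cong (δ (i , a) v +_) φ-source) (+-identityʳ _)) (potential-≤-δ φ φ-edge W)
      where
      φ-source : φ (i , a) ≡ 0
      φ-source = trans (φ-home a) (Block.d-self i a)

  δ-within : ∀ i a b → δ (i , a) (i , b) ≡ d (G i) a b
  δ-within i a b = ≤-antisym (δ-≤ W) (subst (_≤ δ (i , a) (i , b)) (FromSource.φ-home i a b) (FromSource.φ-≤-δ i a (i , b) W))
    where
    W : Walk (d (G i) a b) (i , a) (i , b)
    W = lift (Block.shortest i a b)

  δ-across : ∀ i j a b → pos i < pos j → δ (i , a) (j , b) ≡ d (G i) a (x i) + arc i j + d (G j) (x j) b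
  δ-across i j a b i<j = ≤-antisym upper lower
    where
    W : Walk (d (G j) (x j) b + (arc i j + d (G i) a (x i))) (i , a) (j , b)
    W = (lift (Block.shortest i a (x i)) ++ʷ arcWalk i j (<⇒≤ i<j)) ++ʷ lift (Block.shortest j (x j) b)
    upper : δ (i , a) (j , b) ≤ d (G i) a (x i) + arc i j + d (G j) (x j) b
    upper = subst (δ (i , a) (j , b) ≤_) (trans (+-comm _ (arc i j + _)) (cong (_+ d (G j) (x j) b) (+-comm (arc i j) _))) (δ-≤ W)
    j≢i : j ≢ i
    j≢i j≡i = <-irrefl (cong pos (sym j≡i)) i<j
    lower : d (G i) a (x i) + arc i j + d (G j) (x j) b ≤ δ (i , a) (j , b)
    lower = subst (_≤ δ (i , a) (j , b))
              (trans (FromSource.φ-away i a j b j≢i)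
                     (cong (λ c → d (G i) a (x i) + c + d (G j) (x j) b) (cdist-≤ (pos i) (pos j) (<⇒≤ i<j) (<⇒≤ (toℕ<n j)))))
              (FromSource.φ-≤-δ i a (j , b) W)

  block : Fin k → List CV
  block i = map (i ,_) (allFin (n i))

  term : ℕ → CV × CV → ℕ
  term t (u , v) = t ^ δ u v

  blockTerm : ∀ t i → sum (map (term t) (pairs (block i))) ≡ H (G i) t
  blockTerm t i = begin
      sum (map (term t) (pairs (block i)))
    ≡⟨ cong (sum ∘ map (term t)) (pairs-map (i ,_) (allFin (n i))) ⟩
      sum (map (term t) (map (both (i ,_)) (pairs (allFin (n i)))))
    ≡⟨ sum-map-∘ (term t) (both (i ,_)) (pairs (allFin (n i))) ⟩
      sum (map (λ { (a , b) → t ^ δ (i , a) (i , b) }) (pairs (allFin (n i))))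
    ≡⟨ sum-map-cong (λ { (a , b) → cong (t ^_) (δ-within i a b) }) (pairs (allFin (n i))) ⟩
      H (G i) t
    ∎
    where open ≡-Reasoning

  term-across : ∀ t i j a b → pos i < pos j →
    t ^ δ (i , a) (j , b) ≡ t ^ arc i j * t ^ d (G i) (x i) a * t ^ d (G j) (x j) b
  term-across t i j a b i<j = begin
      t ^ δ (i , a) (j , b)
    ≡⟨ cong (t ^_) (δ-across i j a b i<j) ⟩
      t ^ (d (G i) a (x i) + arc i j + d (G j) (x j) b)
    ≡⟨ ^-distribˡ-+-* t (d (G i) a (x i) + arc i j) (d (G j) (x j) b) ⟩
      t ^ (d (G i) a (x i) + arc i j) * t ^ d (G j) (x j) b
    ≡⟨ cong (_* t ^ d (G j) (x j) b) (^-distribˡ-+-* t (d (G i) a (x i)) (arc i j)) ⟩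
      t ^ d (G i) a (x i) * t ^ arc i j * t ^ d (G j) (x j) b
    ≡⟨ cong (λ l → t ^ l * t ^ arc i j * t ^ d (G j) (x j) b) (Block.d-sym i a (x i)) ⟩
      t ^ d (G i) (x i) a * t ^ arc i j * t ^ d (G j) (x j) b
    ≡⟨ cong (_* t ^ d (G j) (x j) b) (*-comm (t ^ d (G i) (x i) a) (t ^ arc i j)) ⟩
      t ^ arc i j * t ^ d (G i) (x i) a * t ^ d (G j) (x j) b
    ∎
    where open ≡-Reasoning

  crossTerm : ∀ t i j → pos i < pos j →
    crossSum (term t) (block i) (block j) ≡ t ^ arc i j * (1 + Hpart (G i) (x i) t) * (1 + Hpart (G j) (x j) t)
  crossTerm t i j i<j = begin
      crossSum (term t) (block i) (block j)
    ≡⟨ crossSum-map (term t) (i ,_) (j ,_) (allFin (n i)) (allFin (n j)) ⟩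
      sum (map (λ a → sum (map (λ b → t ^ δ (i , a) (j , b)) (allFin (n j)))) (allFin (n i)))
    ≡⟨ sum-map-cong (λ a → sum-map-cong (λ b → term-across t i j a b i<j) (allFin (n j))) (allFin (n i)) ⟩
      sum (map (λ a → sum (map (λ b → t ^ arc i j * powᵢ a * powⱼ b) (allFin (n j)))) (allFin (n i)))
    ≡⟨ sum-map-product (t ^ arc i j) powᵢ powⱼ (allFin (n i)) (allFin (n j)) ⟩
      t ^ arc i j * sum (map powᵢ (allFin (n i))) * sum (map powⱼ (allFin (n j)))
    ≡⟨ cong₂ (λ p q → t ^ arc i j * p * q) (Block.sum-powers-d i (x i) t) (Block.sum-powers-d j (x j) t) ⟩
      t ^ arc i j * (1 + Hpart (G i) (x i) t) * (1 + Hpart (G j) (x j) t)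
    ∎
    where
    open ≡-Reasoning
    powᵢ : Fin (n i) → ℕ
    powᵢ a = t ^ d (G i) (x i) a
    powⱼ : Fin (n j) → ℕ
    powⱼ b = t ^ d (G j) (x j) b

mainTheorem3 : (k : ℕ) → 3 ≤ k →
    (n : Fin k → ℕ) (G : (i : Fin k) → Graph (n i)) → (∀ i → Connected (G i)) →
    (x : (i : Fin k) → Fin (n i)) → (t : ℕ) →
    Circuit.Hcircuit k n G x t
      ≡ sum (map (λ i → H (G i) t) (allFin k))
        + sum (map (λ { (i , j) → t ^ ((toℕ j ∸ toℕ i) ⊓ (k ∸ toℕ j + toℕ i))
                                   * (1 + Hpart (G i) (x i) t)
                                   * (1 + Hpart (G j) (x j) t) })
                   (indexPairs k))
mainTheorem3 k 3≤k n G conn x t = begin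
    Circuit.Hcircuit k n G x t
  ≡⟨ sum-pairs-concatMap (term t) block (allFin k) ⟩
    sum (map (λ i → sum (map (term t) (pairs (block i)))) (allFin k))
      + sum (map (λ { (i , j) → crossSum (term t) (block i) (block j) }) (pairs (allFin k)))
  ≡⟨ cong₂ _+_ (sum-map-cong (blockTerm t) (allFin k))
               (sum-map-cong-local (All.map (λ { {i , j} → crossTerm t i j }) (pairs-AllPairs (tabulate⁺-< (λ i<j → i<j))))) ⟩
    sum (map (λ i → H (G i) t) (allFin k))
      + sum (map (λ { (i , j) → t ^ arc i j * (1 + Hpart (G i) (x i) t) * (1 + Hpart (G j) (x j) t) }) (indexPairs k))
  ∎
  where
  open ≡-Reasoning
  open CircuitDistance k (<⇒≤ 3≤k) n G conn x
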